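{- Let $n\ge 1$, let $\mathcal{M}$ be a polytopal maniplex of rank $n$, let $F$ be a facet of $\mathcal{M}$, let $-1\le i<n$, and let $G_i$ and $G_n$ be incident faces of $\mathrm{Pos}(\mathcal{M}^F)$ of ranks $i$ and $n$, respectively. Then the section $G_n/G_i$ is flag-connected.
   Context: An $n$-maniplex is a connected simple graph whose vertices (flags) have edges properly coloured with colours $0,\dots,n-1$, each flag on exactly one edge of each colour, such that for $|i-j|>1$ the $i$- and $j$-edges form alternating $4$-cycles. $r_i$ maps each flag to its $i$-neighbour. For $0\le i\le n-1$, the $i$-face $\mathcal{M}_{\bar i}(\Phi)$ is the connected component containing $\Phi$ of the graph obtained by deleting all $i$-edges; facets are $(n-1)$-faces. $\mathrm{Pos}(\mathcal{M})$ consists of all $i$-faces ($0\le i\le n-1$, rank $i$) plus a least element of rank $-1$ and greatest element of rank $n$; faces of ranks $i\le j$ satisfy $F_i\le F_j$ iff they share a flag; incident means comparable. A section $G/H$ is $\{K:H\le K\le G\}$. Diamond condition: whenever $H<G$ with ranks differing by $2$, exactly two $K$ satisfy $H<K<G$. Two maximal chains are adjacent if they differ in exactly one element; a poset is flag-connected if any two maximal chains are joined by a sequence of maximal chains with consecutive ones adjacent; strongly flag-connected if every section is flag-connected. $\mathcal{M}$ is polytopal if $\mathrm{Pos}(\mathcal{M})$ satisfies the diamond condition and is strongly flag-connected. $\mathcal{M}^F$ is the $(n+1)$-maniplex with flags $(\Phi,x)$, $\Phi$ a flag of $\mathcal{M}$, $x\in\mathbb{Z}_2^2$, whose $i$-edges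 join $(\Phi,x)$ to $s_i(\Phi,x)$, where $s_i(\Phi,x)=(r_i\Phi,x)$ for $i\le n-1$, $s_n(\Phi,x)=(\Phi,x+(1,0))$ if $\Phi\notin F$, $s_n(\Phi,x)=(\Phi,x+(1,1))$ if $\Phi\in F$; $\mathrm{Pos}(\mathcal{M}^F)$ is defined analogously with ranks $-1,\dots,n+1$. -}

module Defs where

open import Data.Nat using (ℕ; zero; suc; _≤_; _<_; ∣_-_∣)
open import Data.Fin using (Fin; toℕ; fromℕ; inject₁)
open import Data.Bool using (Bool; not)
open import Data.Product using (Σ; ∃; _×_; _,_)
open import Data.Sum using (_⊎_)
open import Data.Unit using (⊤)
open import Data.Empty using (⊥)
open import Relation.Nullary using (¬_)
open import Relation.Binary.PropositionalEquality using (_≡_; _≢_)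
open import Relation.Binary.Construct.Closure.ReflexiveTransitive using (Star)
open import Level using (Level)

record Maniplex (n : ℕ) : Set₁ where
  field
    Flag  : Set
    r     : Fin n → Flag → Flag
    -- r i Φ is the unique i-neighbour of Φ (so edges of colour i are
    -- the pairs {Φ , r i Φ}; r i is an involution)
    invol : ∀ i Φ → r i (r i Φ) ≡ Φ
    noLoop : ∀ i Φ → r i Φ ≢ Φ
    noMulti : ∀ i j Φ → i ≢ j → r i Φ ≢ r j Φ
    -- alternating 4-cycles for |i - j| > 1
    comm  : ∀ i j Φ → 1 < ∣ toℕ i - toℕ j ∣ → r i (r j Φ) ≡ r j (r i Φ)
    connected : ∀ Φ Ψ → Star (λ A B → ∃ λ i → r i A ≡ B) Φ Ψ

-- Ranked structures (with face equality ≈), sections, chains,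
-- flag-connectivity, diamond condition.
-- Ranks are shifted by one: rank -1 is encoded as 0, rank j as suc j.

record RPos : Set₁ where
  field
    Carrier : Set
    _≈ᴾ_    : Carrier → Carrier → Set
    _≤ᴾ_    : Carrier → Carrier → Set
    rank    : Carrier → ℕ

module _ (P : RPos) where
  open RPos P

  Subset : Set₁
  Subset = Carrier → Set

  _<ᴾ_ : Carrier → Carrier → Set
  a <ᴾ b = a ≤ᴾ b × ¬ (a ≈ᴾ b)

  Incident : Carrier → Carrier → Set
  Incident a b = a ≤ᴾ b ⊎ b ≤ᴾ a

  Section : Carrier → Carrier → Subset
  Section G H K = H ≤ᴾ K × K ≤ᴾ G

  IsChainIn : Subset → Subset → Set
  IsChainIn S C =
    (∀ x → C x → S x) ×
    (∀ x y → x ≈ᴾ y → C x → C y) ×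
    (∀ x y → C x → C y → Incident x y)

  IsMaxChainIn : Subset → Subset → Set₁
  IsMaxChainIn S C =
    IsChainIn S C ×
    (∀ D → IsChainIn S D → (∀ x → C x → D x) → ∀ x → D x → C x)

  Adjacent : Subset → Subset → Set
  Adjacent C D = Σ Carrier λ a → Σ Carrier λ b →
    C a × ¬ D a × D b × ¬ C b ×
    (∀ x → C x → ¬ D x → x ≈ᴾ a) ×
    (∀ x → D x → ¬ C x → x ≈ᴾ b)

  MaxStep : Subset → Subset → Subset → Set₁
  MaxStep S C D = IsMaxChainIn S D × Adjacent C D

  -- sets are compared extensionally at the end of a sequence
  FlagConnectedIn : Subset → Set₁
  FlagConnectedIn S = ∀ C D → IsMaxChainIn S C → IsMaxChainIn S D →
    Σ Subset λ E → Star (MaxStep S) C E × (∀ x → (E x → D x) × (D x → E x))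

  StronglyFlagConnected : Set₁
  StronglyFlagConnected = ∀ G H → FlagConnectedIn (Section G H)

  Between : Carrier → Carrier → Carrier → Set
  Between H G K = H <ᴾ K × K <ᴾ G

  Diamond : Set
  Diamond = ∀ H G → H <ᴾ G → rank G ≡ suc (suc (rank H)) →
    Σ Carrier λ K₁ → Σ Carrier λ K₂ →
      Between H G K₁ × Between H G K₂ × ¬ (K₁ ≈ᴾ K₂) ×
      (∀ K → Between H G K → K ≈ᴾ K₁ ⊎ K ≈ᴾ K₂)

-- Pos of a properly edge-coloured graph with colours Fin k, given by an
-- adjacency relation (edges are undirected: symmetric closure is used).

module _ {k : ℕ} {Flag : Set} (Adj : Fin k → Flag → Flag → Set) where

  SameFace : Fin k → Flag → Flag → Set
  SameFace i = Star (λ A B → Σ (Fin k) λ j → j ≢ i × (Adj j A B ⊎ Adj j B A))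

  data Face : Set where
    bot : Face
    top : Face
    face : Fin k → Flag → Face      -- the i-face containing Φ

  FaceEq : Face → Face → Set
  FaceEq bot bot = ⊤
  FaceEq top top = ⊤
  FaceEq (face i Φ) (face j Ψ) = Σ (i ≡ j) λ _ → SameFace i Φ Ψ
  FaceEq _ _ = ⊥

  FaceLe : Face → Face → Set
  FaceLe bot _ = ⊤
  FaceLe _ top = ⊤
  FaceLe (face i Φ) (face j Ψ) =
    toℕ i ≤ toℕ j × Σ Flag (λ X → SameFace i Φ X × SameFace j Ψ X)
  FaceLe _ _ = ⊥

  faceRank : Face → ℕ
  faceRank bot = zero
  faceRank top = suc k
  faceRank (face i _) = suc (toℕ i)

  GraphPos : RPos
  GraphPos = record { Carrier = Face ; _≈ᴾ_ = FaceEq ; _≤ᴾ_ = FaceLe ; rank = faceRank }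

module _ {n : ℕ} (M : Maniplex n) where
  open Maniplex M

  ManAdj : Fin n → Flag → Flag → Set
  ManAdj i Φ Ψ = r i Φ ≡ Ψ

  Pos : RPos
  Pos = GraphPos ManAdj

  Polytopal : Set₁
  Polytopal = Diamond Pos × StronglyFlagConnected Pos

-- Z₂² as Bool × Bool (true = 1)
Z2² : Set
Z2² = Bool × Bool

add10 : Z2² → Z2²
add10 (a , b) = (not a , b)

add11 : Z2² → Z2²
add11 (a , b) = (not a , not b)

-- M of rank suc m, facet F = the (n-1)-face of the flag Φ₀
module _ {m : ℕ} (M : Maniplex (suc m)) (Φ₀ : Maniplex.Flag M) where
  open Maniplex M

  InF : Flag → Set
  InF Φ = SameFace (ManAdj M) (fromℕ m) Φ₀ Φ

  MFAdj : Fin (suc (suc m)) → Flag × Z2² → Flag × Z2² → Set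
  MFAdj i (Φ , x) (Ψ , y) =
    (Σ (Fin (suc m)) λ j → i ≡ inject₁ j × r j Φ ≡ Ψ × x ≡ y) ⊎
    (i ≡ fromℕ (suc m) × Φ ≡ Ψ ×
      ((¬ InF Φ × y ≡ add10 x) ⊎ (InF Φ × y ≡ add11 x)))

  PosMF : RPos
  PosMF = GraphPos MFAdj

module Submission where

open import Defs
open import Function using (_∘_)
open import Data.Nat using (ℕ; suc; _≤_; _<_; s≤s; z≤n)
import Data.Nat.Properties as ℕ
open import Data.Fin using (Fin; toℕ; fromℕ; inject₁)
open import Data.Fin.Properties
  using (toℕ<n; toℕ-fromℕ; toℕ-inject₁; inject₁ℕ≤; inject₁ℕ<; inject₁-injective; fromℕ≢inject₁; toℕ-inject₁-≢)
open import Data.Fin.Relation.Unary.Top using (View; ‵fromℕ; ‵inj₁; view; view-fromℕ; view-inject₁)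
open import Data.Product using (Σ; _×_; _,_; proj₁; proj₂)
open import Data.Sum using (_⊎_; inj₁; inj₂; swap) renaming (map to ⊎-map)
open import Data.Unit using (tt)
open import Data.Empty using (⊥-elim)
open import Relation.Unary using (_≐_)
open import Relation.Unary.Properties using (≐-refl; ≐-sym; ≐-trans)
open import Relation.Binary.PropositionalEquality using (_≡_; _≢_; refl; sym; trans; cong; subst; subst₂)
open import Relation.Binary.Construct.Closure.ReflexiveTransitive
  using (Star; ε; _◅_; _◅◅_; reverse; gmap; kleisliStar; fold)

-- A rank-n face of M^F is a facet of M^F, i.e. a component of the flag graph
-- with the n-edges deleted. Only n-edges change the Z₂²-coordinate, and the
-- other edges are those of M, so every facet of M^F is a copy of M. Hence the section G_n/G_i of Pos(M^F) is isomorphic, up to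
-- face equality, to a section M/G of Pos(M), which is flag-connected because M
-- is polytopal. Flag-connectivity transfers along such an isomorphism:
-- maximal chains and adjacency steps are pulled back along it.

record Subposet : Set₁ where
  field
    poset : RPos
  open RPos poset public
  field
    member        : Subset poset
    ≈-sym         : ∀ {x y} → x ≈ᴾ y → y ≈ᴾ x
    ≈-trans       : ∀ {x y z} → x ≈ᴾ y → y ≈ᴾ z → x ≈ᴾ z
    ≤-resp-≈      : ∀ {x x′ y y′} → x ≈ᴾ x′ → y ≈ᴾ y′ → x ≤ᴾ y → x′ ≤ᴾ y′
    member-resp-≈ : ∀ {x y} → x ≈ᴾ y → member x → member y

module _ (A : Subposet) where
  open Subposet A

  Chain : Subset poset → Set
  Chain = IsChainIn poset member

  MaxChain : Subset poset → Set₁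
  MaxChain = IsMaxChainIn poset member

  Path : Subset poset → Subset poset → Set₁
  Path = Star (MaxStep poset member)

  FlagConnected : Set₁
  FlagConnected = FlagConnectedIn poset member

module _ (A B : Subposet) where
  private
    module A = Subposet A
    module B = Subposet B

  record _≃_ : Set where
    field
      to          : A.Carrier → B.Carrier
      from        : B.Carrier → A.Carrier
      to-member   : ∀ {x} → A.member x → B.member (to x)
      from-member : ∀ {y} → B.member y → A.member (from y)
      to-cong     : ∀ {x x′} → A.member x → A.member x′ → x A.≈ᴾ x′ → to x B.≈ᴾ to x′
      from-cong   : ∀ {y y′} → B.member y → B.member y′ → y B.≈ᴾ y′ → from y A.≈ᴾ from y′
      to-mono     : ∀ {x x′} → A.member x → A.member x′ → x A.≤ᴾ x′ → to x B.≤ᴾ to x′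
      from-mono   : ∀ {y y′} → B.member y → B.member y′ → y B.≤ᴾ y′ → from y A.≤ᴾ from y′
      from∘to     : ∀ {x} → A.member x → x A.≈ᴾ from (to x)
      to∘from     : ∀ {y} → B.member y → y B.≈ᴾ to (from y)

≃-sym : ∀ {A B} → A ≃ B → B ≃ A
≃-sym e = record
  { to = from ; from = to ; to-member = from-member ; from-member = to-member
  ; to-cong = from-cong ; from-cong = to-cong ; to-mono = from-mono ; from-mono = to-mono
  ; from∘to = to∘from ; to∘from = from∘to }
  where open _≃_ e

module _ {A B : Subposet} (e : A ≃ B) where
  private
    module A = Subposet A
    module B = Subposet B
  open _≃_ e

  pullback : Subset B.poset → Subset A.poset
  pullback D x = A.member x × D (to x)

  pushforward : Subset A.poset → Subset B.poset
  pushforward C y = B.member y × C (from y)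

  to-reflects-≤ : ∀ {x x′} → A.member x → A.member x′ → to x B.≤ᴾ to x′ → x A.≤ᴾ x′
  to-reflects-≤ s s′ le =
    A.≤-resp-≈ (A.≈-sym (from∘to s)) (A.≈-sym (from∘to s′)) (from-mono (to-member s) (to-member s′) le)

  pullback-chain : ∀ {D} → Chain B D → Chain A (pullback D)
  pullback-chain {D} (_ , D-closed , D-incident) = (λ _ → proj₁) , closed , incident
    where
    closed : ∀ x y → x A.≈ᴾ y → pullback D x → pullback D y
    closed x y x≈y (s , d) = s′ , D-closed _ _ (to-cong s s′ x≈y) d
      where s′ = A.member-resp-≈ x≈y s
    incident : ∀ x y → pullback D x → pullback D y → Incident A.poset x y
    incident x y (s , d) (s′ , d′) with D-incident _ _ d d′
    ... | inj₁ le = inj₁ (to-reflects-≤ s s′ le)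
    ... | inj₂ le = inj₂ (to-reflects-≤ s′ s le)

  from-∈-pullback : ∀ {D y} → Chain B D → D y → pullback D (from y)
  from-∈-pullback (D-sub , D-closed , _) d =
    from-member (D-sub _ d) , D-closed _ _ (to∘from (D-sub _ d)) d

  pullback-adjacent : ∀ {D D′} → Chain B D → Chain B D′ →
    Adjacent B.poset D D′ → Adjacent A.poset (pullback D) (pullback D′)
  pullback-adjacent chD@(D-sub , D-closed , _) chD′@(D′-sub , D′-closed , _)
    (a , b , a∈D , a∉D′ , b∈D′ , b∉D , only-a , only-b) =
    from a , from b ,
    from-∈-pullback chD a∈D , (λ (_ , d′) → a∉D′ (D′-closed _ _ (B.≈-sym (to∘from (D-sub a a∈D))) d′)) ,
    from-∈-pullback chD′ b∈D′ , (λ (_ , d) → b∉D (D-closed _ _ (B.≈-sym (to∘from (D′-sub b b∈D′))) d)) ,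
    (λ x (s , d) x∉ → A.≈-trans (from∘to s)
      (from-cong (to-member s) (D-sub a a∈D) (only-a (to x) d λ d′ → x∉ (s , d′)))) ,
    (λ x (s , d′) x∉ → A.≈-trans (from∘to s)
      (from-cong (to-member s) (D′-sub b b∈D′) (only-b (to x) d′ λ d → x∉ (s , d))))

  pullback-resp-≐ : ∀ {D D′} → D ≐ D′ → pullback D ≐ pullback D′
  pullback-resp-≐ (D⊆D′ , D′⊆D) = (λ (s , d) → s , D⊆D′ d) , (λ (s , d′) → s , D′⊆D d′)

  pullback-pushforward : ∀ {C} → Chain A C → pullback (pushforward C) ≐ C
  pullback-pushforward (C-sub , C-closed , _) =
    (λ (s , _ , c) → C-closed _ _ (A.≈-sym (from∘to s)) c) ,
    (λ c → C-sub _ c , to-member (C-sub _ c) , C-closed _ _ (from∘to (C-sub _ c)) c)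

pullback-maxChain : ∀ {A B} (e : A ≃ B) {D} → MaxChain B D → MaxChain A (pullback e D)
pullback-maxChain {A} e {D} (chD@(D-sub , _ , _) , D-maximal) = pullback-chain e chD , maximal
  where
  open _≃_ e
  maximal : ∀ E → Chain A E → (∀ x → pullback e D x → E x) → ∀ x → E x → pullback e D x
  maximal E chE@(E-sub , E-closed , _) D⊆E x x∈E =
    E-sub x x∈E ,
    D-maximal (pushforward e E) (pullback-chain (≃-sym e) chE)
      (λ y y∈D → D-sub y y∈D , D⊆E (from y) (from-∈-pullback e chD y∈D))
      (to x) (to-member (E-sub x x∈E) , E-closed _ _ (from∘to (E-sub x x∈E)) x∈E)

pullback-path : ∀ {A B} (e : A ≃ B) {D E} → MaxChain B D → Path B D E →
  Path A (pullback e D) (pullback e E)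
pullback-path e mD ε = ε
pullback-path e mD ((mD′ , D~D′) ◅ path) =
  (pullback-maxChain e mD′ , pullback-adjacent e (proj₁ mD) (proj₁ mD′) D~D′) ◅ pullback-path e mD′ path

adjacent-respˡ-≐ : ∀ {P : RPos} {C C′ D : Subset P} → C ≐ C′ → Adjacent P C′ D → Adjacent P C D
adjacent-respˡ-≐ (C⊆C′ , C′⊆C) (a , b , a∈C′ , a∉D , b∈D , b∉C′ , only-a , only-b) =
  a , b , C′⊆C a∈C′ , a∉D , b∈D , (λ b∈C → b∉C′ (C⊆C′ b∈C)) ,
  (λ x x∈C → only-a x (C⊆C′ x∈C)) , (λ x x∈D x∉C → only-b x x∈D (λ x∈C′ → x∉C (C′⊆C x∈C′)))

path-respˡ-≐ : ∀ (A : Subposet) {C C′ E} → C ≐ C′ → Path A C′ E →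
  Σ (Subset (Subposet.poset A)) λ E′ → Path A C E′ × E′ ≐ E
path-respˡ-≐ A {C} C≐C′ ε = C , ε , C≐C′
path-respˡ-≐ A {E = E} C≐C′ ((mD , C′~D) ◅ path) =
  E , (mD , adjacent-respˡ-≐ {Subposet.poset A} C≐C′ C′~D) ◅ path , ≐-refl

flagConnected-transport : ∀ {A B} → A ≃ B → FlagConnected B → FlagConnected A
-- The pulled-back path starts at pullback (pushforward C), which is C only up to ≐.
flagConnected-transport {A} e B-connected C D mC mD
  with B-connected (pushforward e C) (pushforward e D)
         (pullback-maxChain (≃-sym e) mC) (pullback-maxChain (≃-sym e) mD)
... | E , path , E≐pushD
  with path-respˡ-≐ A (≐-sym (pullback-pushforward e (proj₁ mC)))
         (pullback-path e (pullback-maxChain (≃-sym e) mC) path)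
... | E′ , path′ , E′≐pullE = E′ , path′ , λ _ → proj₁ E′≐D , proj₂ E′≐D
  where
  E′≐D : E′ ≐ D
  E′≐D = ≐-trans E′≐pullE
    (≐-trans (pullback-resp-≐ e ((λ {x} → proj₁ (E≐pushD x)) , (λ {x} → proj₂ (E≐pushD x))))
             (pullback-pushforward e (proj₁ mD)))

module GraphPosProperties {k : ℕ} {Flag : Set} (Adj : Fin k → Flag → Flag → Set) where
  open RPos (GraphPos Adj)

  FaceStep : Fin k → Flag → Flag → Set
  FaceStep i A B = Σ (Fin k) λ j → j ≢ i × (Adj j A B ⊎ Adj j B A)

  sameFace-sym : ∀ {i Φ Ψ} → SameFace Adj i Φ Ψ → SameFace Adj i Ψ Φ
  sameFace-sym = reverse (λ (j , j≢i , adj) → j , j≢i , swap adj)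

  ≈-refl : ∀ {x} → x ≈ᴾ x
  ≈-refl {bot} = tt
  ≈-refl {top} = tt
  ≈-refl {face i Φ} = refl , ε

  ≈-sym : ∀ {x y} → x ≈ᴾ y → y ≈ᴾ x
  ≈-sym {bot} {bot} _ = tt
  ≈-sym {top} {top} _ = tt
  ≈-sym {face i Φ} {face .i Ψ} (refl , Φ~Ψ) = refl , sameFace-sym Φ~Ψ

  ≈-trans : ∀ {x y z} → x ≈ᴾ y → y ≈ᴾ z → x ≈ᴾ z
  ≈-trans {bot} {bot} {bot} _ _ = tt
  ≈-trans {top} {top} {top} _ _ = tt
  ≈-trans {face i Φ} {face .i Ψ} {face .i Θ} (refl , Φ~Ψ) (refl , Ψ~Θ) = refl , (Φ~Ψ ◅◅ Ψ~Θ)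

  ≤-refl : ∀ {x} → x ≤ᴾ x
  ≤-refl {bot} = tt
  ≤-refl {top} = tt
  ≤-refl {face i Φ} = ℕ.≤-refl , Φ , ε , ε

  ≤-top : ∀ {x} → x ≤ᴾ top
  ≤-top {bot} = tt
  ≤-top {top} = tt
  ≤-top {face i Φ} = tt

  ≤-resp-≈ : ∀ {x x′ y y′} → x ≈ᴾ x′ → y ≈ᴾ y′ → x ≤ᴾ y → x′ ≤ᴾ y′
  ≤-resp-≈ {bot} {bot} _ _ _ = tt
  ≤-resp-≈ {top} {top} {top} {top} _ _ _ = tt
  ≤-resp-≈ {face i Φ} {face i′ Φ′} {top} {top} _ _ _ = tt
  ≤-resp-≈ {face i Φ} {face i′ Φ′} {face j Ψ} {face j′ Ψ′}
    (refl , Φ~Φ′) (refl , Ψ~Ψ′) (i≤j , Ξ , Φ~Ξ , Ψ~Ξ) =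
    i≤j , Ξ , sameFace-sym Φ~Φ′ ◅◅ Φ~Ξ , sameFace-sym Ψ~Ψ′ ◅◅ Ψ~Ξ

  rank-mono : ∀ {x y} → x ≤ᴾ y → rank x ≤ rank y
  rank-mono {bot} _ = z≤n
  rank-mono {top} {top} _ = ℕ.≤-refl
  rank-mono {face i Φ} {top} _ = s≤s (ℕ.<⇒≤ (toℕ<n i))
  rank-mono {face i Φ} {face j Ψ} (i≤j , _) = s≤s i≤j

  incident-rank< : ∀ {x y} → Incident (GraphPos Adj) x y → rank x < rank y → x ≤ᴾ y
  incident-rank< (inj₁ x≤y) _ = x≤y
  incident-rank< (inj₂ y≤x) x<y = ⊥-elim (ℕ.<⇒≱ x<y (rank-mono y≤x))

  sectionSubposet : Face Adj → Face Adj → Subposet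
  sectionSubposet G H = record
    { poset = GraphPos Adj
    ; member = Section (GraphPos Adj) G H
    ; ≈-sym = ≈-sym
    ; ≈-trans = ≈-trans
    ; ≤-resp-≈ = ≤-resp-≈
    ; member-resp-≈ = λ x≈y (H≤x , x≤G) → ≤-resp-≈ ≈-refl x≈y H≤x , ≤-resp-≈ x≈y ≈-refl x≤G
    }

module _ {m : ℕ} (M : Maniplex (suc m)) (Φ₀ : Maniplex.Flag M) where
  open Maniplex M
  private
    module ᴹ = GraphPosProperties (ManAdj M)
    module ᶠ = GraphPosProperties (MFAdj M Φ₀)
    open RPos (Pos M) using () renaming (_≈ᴾ_ to _≈ᴹ_; _≤ᴾ_ to _≤ᴹ_)
    open RPos (PosMF M Φ₀) using () renaming (_≈ᴾ_ to _≈ᶠ_; _≤ᴾ_ to _≤ᶠ_)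

  sameFace-proj₁ : ∀ {j A B} → SameFace (MFAdj M Φ₀) (inject₁ j) A B →
    SameFace (ManAdj M) j (proj₁ A) (proj₁ B)
  sameFace-proj₁ = kleisliStar proj₁ step
    where
    step : ∀ {j A B} → ᶠ.FaceStep (inject₁ j) A B → SameFace (ManAdj M) j (proj₁ A) (proj₁ B)
    step (_ , c≢ , inj₁ (inj₁ (j′ , refl , r≡ , _))) = (j′ , c≢ ∘ cong inject₁ , inj₁ r≡) ◅ ε
    step (_ , _ , inj₁ (inj₂ (_ , refl , _))) = ε
    step (_ , c≢ , inj₂ (inj₁ (j′ , refl , r≡ , _))) = (j′ , c≢ ∘ cong inject₁ , inj₂ r≡) ◅ ε
    step (_ , _ , inj₂ (inj₂ (_ , refl , _))) = ε

  sameFace-proj₂ : ∀ {A B} → SameFace (MFAdj M Φ₀) (fromℕ (suc m)) A B → proj₂ A ≡ proj₂ B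
  sameFace-proj₂ = fold (λ A B → proj₂ A ≡ proj₂ B) (trans ∘ step) refl
    where
    step : ∀ {A B} → ᶠ.FaceStep (fromℕ (suc m)) A B → proj₂ A ≡ proj₂ B
    step (_ , _ , inj₁ (inj₁ (_ , _ , _ , x≡y))) = x≡y
    step (_ , _ , inj₂ (inj₁ (_ , _ , _ , y≡x))) = sym y≡x
    step (_ , c≢ , inj₁ (inj₂ (refl , _))) = ⊥-elim (c≢ refl)
    step (_ , c≢ , inj₂ (inj₂ (refl , _))) = ⊥-elim (c≢ refl)

  sameFace-lift : ∀ {j Φ Ψ} z → SameFace (ManAdj M) j Φ Ψ →
    SameFace (MFAdj M Φ₀) (inject₁ j) (Φ , z) (Ψ , z)
  sameFace-lift z = gmap (_, z) step
    where
    step : ∀ {j Φ Ψ} → ᴹ.FaceStep j Φ Ψ → ᶠ.FaceStep (inject₁ j) (Φ , z) (Ψ , z)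
    step (j′ , j′≢j , adj) = inject₁ j′ , j′≢j ∘ inject₁-injective , ⊎-map edge edge adj
      where
      edge : ∀ {Φ Ψ} → r j′ Φ ≡ Ψ → MFAdj M Φ₀ (inject₁ j′) (Φ , z) (Ψ , z)
      edge r≡ = inj₁ (j′ , refl , r≡ , refl)

  facet-sameFace : ∀ z Φ Ψ → SameFace (MFAdj M Φ₀) (fromℕ (suc m)) (Φ , z) (Ψ , z)
  facet-sameFace z Φ Ψ = gmap (_, z) step (connected Φ Ψ)
    where
    step : ∀ {Φ Ψ} → (Σ (Fin (suc m)) λ i → r i Φ ≡ Ψ) → ᶠ.FaceStep (fromℕ (suc m)) (Φ , z) (Ψ , z)
    step (i , r≡) = inject₁ i , fromℕ≢inject₁ ∘ sym , inj₁ (inj₁ (i , refl , r≡ , refl))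

  collapseAt : ∀ {c : Fin (suc (suc m))} → View c → Flag → Face (ManAdj M)
  collapseAt ‵fromℕ Φ = top
  collapseAt (‵inj₁ {i = j} _) Φ = face j Φ

  collapse : Face (MFAdj M Φ₀) → Face (ManAdj M)
  collapse bot = bot
  collapse top = top
  collapse (face c (Φ , _)) = collapseAt (view c) Φ

  facet : Flag × Z2² → Face (MFAdj M Φ₀)
  facet = face (fromℕ (suc m))

  inFacet : Flag × Z2² → Face (ManAdj M) → Face (MFAdj M Φ₀)
  inFacet A bot = bot
  inFacet A top = facet A
  inFacet (_ , z) (face j Φ) = face (inject₁ j) (Φ , z)

  collapse-cong : ∀ {x y} → x ≈ᶠ y → collapse x ≈ᴹ collapse y
  collapse-cong {bot} {bot} _ = tt
  collapse-cong {top} {top} _ = tt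
  collapse-cong {face c _} {face .c _} (refl , A~B) with view c
  ... | ‵fromℕ = tt
  ... | ‵inj₁ _ = refl , sameFace-proj₁ A~B

  collapse-mono : ∀ {x y} → x ≤ᶠ y → collapse x ≤ᴹ collapse y
  collapse-mono {bot} _ = tt
  collapse-mono {x} {top} _ = ᴹ.≤-top {collapse x}
  collapse-mono {face c _} {face c′ _} (c≤c′ , Ξ , A~Ξ , B~Ξ) with view c | view c′
  ... | _ | ‵fromℕ = ᴹ.≤-top
  ... | ‵fromℕ | ‵inj₁ {i = j′} _ =
    ⊥-elim (ℕ.<⇒≱ (inject₁ℕ< j′) (subst (_≤ toℕ (inject₁ j′)) (toℕ-fromℕ (suc m)) c≤c′))
  ... | ‵inj₁ {i = j} _ | ‵inj₁ {i = j′} _ =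
    subst₂ _≤_ (toℕ-inject₁ j) (toℕ-inject₁ j′) c≤c′ , proj₁ Ξ , sameFace-proj₁ A~Ξ , sameFace-proj₁ B~Ξ

  module _ (A : Flag × Z2²) where

    inFacet-cong : ∀ {y y′} → y ≈ᴹ y′ → inFacet A y ≈ᶠ inFacet A y′
    inFacet-cong {bot} {bot} _ = tt
    inFacet-cong {top} {top} _ = ᶠ.≈-refl {facet A}
    inFacet-cong {face j _} {face .j _} (refl , Φ~Ψ) = refl , sameFace-lift (proj₂ A) Φ~Ψ

    inFacet-≤-facet : ∀ y → inFacet A y ≤ᶠ facet A
    inFacet-≤-facet bot = tt
    inFacet-≤-facet top = ᶠ.≤-refl {facet A}
    inFacet-≤-facet (face j Φ) =
      subst (toℕ (inject₁ j) ≤_) (sym (toℕ-fromℕ (suc m))) (inject₁ℕ≤ j) ,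
      (Φ , proj₂ A) , ε , facet-sameFace (proj₂ A) (proj₁ A) Φ

    inFacet-mono : ∀ {y y′} → y ≤ᴹ y′ → inFacet A y ≤ᶠ inFacet A y′
    inFacet-mono {bot} _ = tt
    inFacet-mono {y} {top} _ = inFacet-≤-facet y
    inFacet-mono {face j _} {face j′ _} (j≤j′ , Ξ , Φ~Ξ , Ψ~Ξ) =
      subst₂ _≤_ (sym (toℕ-inject₁ j)) (sym (toℕ-inject₁ j′)) j≤j′ ,
      (Ξ , proj₂ A) , sameFace-lift (proj₂ A) Φ~Ξ , sameFace-lift (proj₂ A) Ψ~Ξ

    collapse-inFacet : ∀ y → y ≈ᴹ collapse (inFacet A y)
    collapse-inFacet bot = tt
    collapse-inFacet top rewrite view-fromℕ (suc m) = tt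
    collapse-inFacet (face j Φ) rewrite view-inject₁ j = refl , ε

    inFacet-collapse : ∀ {x} → x ≤ᶠ facet A → x ≈ᶠ inFacet A (collapse x)
    inFacet-collapse {bot} _ = tt
    inFacet-collapse {face c B} (_ , Ξ , B~Ξ , A~Ξ) with view c
    ... | ‵fromℕ = refl , B~Ξ ◅◅ ᶠ.sameFace-sym A~Ξ
    -- Ξ is a flag of both faces, so it lies in A's copy of M; return from Ξ to B inside that copy.
    ... | ‵inj₁ _ with sameFace-proj₂ A~Ξ
    ...   | refl = refl , B~Ξ ◅◅ sameFace-lift (proj₂ A) (ᴹ.sameFace-sym (sameFace-proj₁ B~Ξ))

    facetSection≃ : ∀ {G} → G ≤ᶠ facet A →
      ᶠ.sectionSubposet (facet A) G ≃ ᴹ.sectionSubposet top (collapse G)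
    facetSection≃ G≤F = record
      { to = collapse
      ; from = inFacet A
      ; to-member = λ (G≤x , _) → collapse-mono G≤x , ᴹ.≤-top
      ; from-member = λ {y} (cG≤y , _) →
          ᶠ.≤-resp-≈ (ᶠ.≈-sym (inFacet-collapse G≤F)) ᶠ.≈-refl (inFacet-mono cG≤y) , inFacet-≤-facet y
      ; to-cong = λ _ _ → collapse-cong
      ; from-cong = λ _ _ → inFacet-cong
      ; to-mono = λ _ _ → collapse-mono
      ; from-mono = λ _ _ → inFacet-mono
      ; from∘to = λ (_ , x≤F) → inFacet-collapse x≤F
      ; to∘from = λ {y} _ → collapse-inFacet y
      }

  rank-facet : ∀ A → RPos.rank (PosMF M Φ₀) (facet A) ≡ suc (suc m)
  rank-facet _ = cong suc (toℕ-fromℕ (suc m))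

  rank-facet⁻¹ : ∀ G → RPos.rank (PosMF M Φ₀) G ≡ suc (suc m) →
    Σ (Flag × Z2²) λ A → G ≡ facet A
  rank-facet⁻¹ bot ()
  rank-facet⁻¹ top rank≡ = ⊥-elim (ℕ.1+n≢n rank≡)
  rank-facet⁻¹ (face c A) rank≡ with view c
  ... | ‵fromℕ = A , refl
  ... | ‵inj₁ {i = j} _ = ⊥-elim (toℕ-inject₁-≢ j (sym (ℕ.suc-injective rank≡)))

mainTheorem4 : (m : ℕ) (M : Maniplex (suc m)) → Polytopal M →
    (Φ₀ : Maniplex.Flag M) →
    (Gi Gn : RPos.Carrier (PosMF M Φ₀)) →
    RPos.rank (PosMF M Φ₀) Gi ≤ suc m →
    RPos.rank (PosMF M Φ₀) Gn ≡ suc (suc m) →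
    Incident (PosMF M Φ₀) Gi Gn →
    FlagConnectedIn (PosMF M Φ₀) (Section (PosMF M Φ₀) Gn Gi)
mainTheorem4 m M (_ , stronglyFlagConnected) Φ₀ Gi Gn rank-Gi rank-Gn Gi~Gn
  with rank-facet⁻¹ M Φ₀ Gn rank-Gn
... | A , refl =
  flagConnected-transport (facetSection≃ M Φ₀ A Gi≤facet) (stronglyFlagConnected top (collapse M Φ₀ Gi))
  where
  Gi≤facet : RPos._≤ᴾ_ (PosMF M Φ₀) Gi (facet M Φ₀ A)
  Gi≤facet = GraphPosProperties.incident-rank< (MFAdj M Φ₀) Gi~Gn
    (subst (RPos.rank (PosMF M Φ₀) Gi <_) (sym (rank-facet M Φ₀ A)) (s≤s rank-Gi))
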